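{- Let $\Gamma$ be a finitely generated infinite simple group and $S$ a finite generating set of $\Gamma$ not containing the identity, such that $G=\mathrm{Cay}(\Gamma,S)$ is a graphical regular representation of $\Gamma$. Then every periodic vertex-coloring of $G$ is trivial. Moreover, if $S$ contains an element of order 2, then $G$ does not have a periodic orientation.
   Context: $\mathrm{Cay}(\Gamma,S)$ has vertex set $\Gamma$, with $g,h$ adjacent iff $hg^{ -1}\in S\cup S^{ -1}$; $\Gamma$ acts on it by right multiplications, and it is a graphical regular representation if its automorphism group consists exactly of these right multiplications. A group is simple if its only normal subgroups are itself and the trivial subgroup. A vertex-coloring is trivial if all vertices of each connected component get the same color. A vertex-coloring (resp. orientation) is periodic if the subgroup of automorphisms mapping each vertex to a vertex of the same color (resp. each edge to an edge with the same orientation) has finitely many orbits on $V(G)$. -}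

module Defs where

open import Level using (0ℓ)
open import Data.Empty using (⊥)
open import Data.List using (List)
open import Data.List.Membership.Propositional using (_∈_)
open import Data.Product using (Σ; ∃; _×_; _,_)
open import Data.Sum using (_⊎_)
open import Relation.Nullary using (¬_)
open import Relation.Binary.PropositionalEquality using (_≡_)
open import Relation.Binary.Construct.Closure.ReflexiveTransitive using (Star)
open import Algebra.Structures using (IsGroup)

record Grp : Set₁ where
  field
    Carrier : Set
    _∙_     : Carrier → Carrier → Carrier
    ε       : Carrier
    _⁻¹     : Carrier → Carrier
    isGroup : IsGroup _≡_ _∙_ ε _⁻¹

module _ (Γ : Grp) where
  open Grp Γ

  IsInfinite : Set
  IsInfinite = ¬ (Σ (List Carrier) λ xs → (x : Carrier) → x ∈ xs)

  record IsNormalSubgroup (N : Carrier → Set) : Set where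
    field
      has-ε  : N ε
      ∙-closed : ∀ {x y} → N x → N y → N (x ∙ y)
      ⁻¹-closed : ∀ {x} → N x → N (x ⁻¹)
      conj-closed : ∀ {x} (g : Carrier) → N x → N ((g ∙ x) ∙ (g ⁻¹))

  IsSimple : Set₁
  IsSimple = (N : Carrier → Set) → IsNormalSubgroup N →
             ((x : Carrier) → N x → x ≡ ε) ⊎ ((x : Carrier) → N x)

  module _ (S : List Carrier) where

    data Generated : Carrier → Set where
      gen-ε   : Generated ε
      gen-s   : ∀ {x s} → Generated x → s ∈ S → Generated (x ∙ s)
      gen-s⁻¹ : ∀ {x s} → Generated x → s ∈ S → Generated (x ∙ (s ⁻¹))

    Generates : Set
    Generates = (x : Carrier) → Generated x

    Adj : Carrier → Carrier → Set
    Adj g h = ((h ∙ (g ⁻¹)) ∈ S) ⊎ (((h ∙ (g ⁻¹)) ⁻¹) ∈ S)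

    record Aut : Set where
      field
        to      : Carrier → Carrier
        from    : Carrier → Carrier
        to-from : (x : Carrier) → to (from x) ≡ x
        from-to : (x : Carrier) → from (to x) ≡ x
        adj-to  : ∀ g h → Adj g h → Adj (to g) (to h)
        adj-from : ∀ g h → Adj (to g) (to h) → Adj g h
    open Aut public

    IsGRR : Set
    IsGRR = (φ : Aut) → Σ Carrier λ γ → (g : Carrier) → to φ g ≡ g ∙ γ

    FinitelyManyOrbits : (Aut → Set) → Set
    FinitelyManyOrbits H =
      Σ (List Carrier) λ reps → (v : Carrier) →
        Σ Carrier λ r → r ∈ reps × Σ Aut λ φ → H φ × to φ r ≡ v

    ColorPreserving : {C : Set} → (Carrier → C) → Aut → Set
    ColorPreserving c φ = (g : Carrier) → c (to φ g) ≡ c g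

    PeriodicColoring : {C : Set} → (Carrier → C) → Set
    PeriodicColoring c = FinitelyManyOrbits (ColorPreserving c)

    Connected : Carrier → Carrier → Set
    Connected = Star Adj

    TrivialColoring : {C : Set} → (Carrier → C) → Set
    TrivialColoring c = ∀ g h → Connected g h → c g ≡ c h

    -- orientations: O g h means the edge {g,h} is oriented from g to h
    record IsOrientation (O : Carrier → Carrier → Set) : Set where
      field
        only-edges : ∀ g h → O g h → Adj g h
        total      : ∀ g h → Adj g h → O g h ⊎ O h g
        antisym    : ∀ g h → O g h → O h g → ⊥

    OrientationPreserving : (Carrier → Carrier → Set) → Aut → Set
    OrientationPreserving O φ = ∀ g h → O g h → O (to φ g) (to φ h)

    HasPeriodicOrientation : Set₁
    HasPeriodicOrientation =
      Σ (Carrier → Carrier → Set) λ O →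
        IsOrientation O × FinitelyManyOrbits (OrientationPreserving O)

{-# OPTIONS --safe #-}

-- In a GRR every colour- or orientation-preserving automorphism is a right
-- multiplication, so periodicity says that the subgroup N of right multiplications
-- preserving the structure has finite index. Left multiplication permutes the finitely
-- many cosets rN, with kernel the normal core of N. A trivial core would embed Γ into
-- the finite set of self-maps of the cosets, making the finitely generated group Γ
-- finite; so by simplicity the core, and with it N, is all of Γ. Hence colourings are
-- constant, and an involution s ∈ S would reverse the edge {ε, s}.

module Submission where

open import Defs
open import Level using (0ℓ)
open import Function using (_∘_)
open import Function.Definitions using (Injective)
open import Algebra.Bundles using (Group)
open import Algebra.Structures using (IsGroup)
open import Data.Empty using (⊥-elim)
open import Data.Fin.Base as Fin using (Fin; toℕ; funToFin; finToFun)
open import Data.Fin.Properties using (finToFun-funToFin; pigeonhole; any?)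
  renaming (_≟_ to _≟ᶠ_)
open import Data.List using (List; [_]; _++_; map; cartesianProductWith; length; lookup)
open import Data.List.Membership.Propositional using (_∈_; _∉_; find)
open import Data.List.Membership.Propositional.Properties
  using (∈-++⁺ˡ; ∈-++⁺ʳ; ∈-map⁺; ∈-cartesianProductWith⁺)
open import Data.List.Relation.Unary.Any using (here; index)
open import Data.List.Relation.Unary.Any.Properties using (lookup-index)
open import Data.List.Relation.Unary.All as All using (All)
open import Data.List.Relation.Unary.All.Properties using (¬All⇒Any¬)
open import Data.Nat.Base using (ℕ; zero; suc; _^_; _≤′_; ≤′-refl; ≤′-step)
open import Data.Nat.Properties using (n<1+n; ≤⇒≤′)
open import Data.Product using (Σ; _×_; _,_; proj₁; proj₂)
open import Data.Sum using (_⊎_; inj₁; inj₂)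
open import Relation.Binary.Definitions using (DecidableEquality)
open import Relation.Nullary using (¬_; Dec; yes; no)
open import Relation.Nullary.Decidable using (map′)
open import Relation.Binary.PropositionalEquality
  using (_≡_; refl; sym; trans; cong; subst; subst₂; module ≡-Reasoning)

module _ (Γ : Grp) where
  open Grp Γ renaming (_∙_ to infixl 7 _∙_)
  open IsGroup isGroup using (assoc; identityˡ; identityʳ; inverseˡ; _\\_; _//_)
  open ≡-Reasoning

  private
    group : Group 0ℓ 0ℓ
    group = record { isGroup = isGroup }

  open import Algebra.Properties.Group group
    using (ε⁻¹≈ε; ⁻¹-involutive; ⁻¹-anti-homo-∙;
           \\-leftDividesˡ; \\-leftDividesʳ; //-rightDividesˡ; //-rightDividesʳ)

  conj : Carrier → Carrier → Carrier
  conj g z = g ⁻¹ ∙ z ∙ g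

  conj-∙ : ∀ g x y → conj g (x ∙ y) ≡ conj g x ∙ conj g y
  conj-∙ g x y = begin
    g ⁻¹ ∙ (x ∙ y) ∙ g              ≡⟨ cong (_∙ g) (assoc (g ⁻¹) x y) ⟨
    g ⁻¹ ∙ x ∙ y ∙ g                ≡⟨ assoc (g ⁻¹ ∙ x) y g ⟩
    g ⁻¹ ∙ x ∙ (y ∙ g)              ≡⟨ cong (λ t → g ⁻¹ ∙ x ∙ (t ∙ g)) (\\-leftDividesˡ g y) ⟨
    g ⁻¹ ∙ x ∙ (g ∙ (g ⁻¹ ∙ y) ∙ g) ≡⟨ cong (g ⁻¹ ∙ x ∙_) (assoc g (g ⁻¹ ∙ y) g) ⟩
    g ⁻¹ ∙ x ∙ (g ∙ (g ⁻¹ ∙ y ∙ g)) ≡⟨ assoc (g ⁻¹ ∙ x) g _ ⟨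
    g ⁻¹ ∙ x ∙ g ∙ (g ⁻¹ ∙ y ∙ g)   ∎

  conj-⁻¹ : ∀ g x → conj g (x ⁻¹) ≡ conj g x ⁻¹
  conj-⁻¹ g x = begin
    g ⁻¹ ∙ x ⁻¹ ∙ g          ≡⟨ assoc (g ⁻¹) (x ⁻¹) g ⟩
    g ⁻¹ ∙ (x ⁻¹ ∙ g)        ≡⟨ cong (λ t → g ⁻¹ ∙ (x ⁻¹ ∙ t)) (⁻¹-involutive g) ⟨
    g ⁻¹ ∙ (x ⁻¹ ∙ g ⁻¹ ⁻¹)  ≡⟨ cong (g ⁻¹ ∙_) (⁻¹-anti-homo-∙ (g ⁻¹) x) ⟨
    g ⁻¹ ∙ (g ⁻¹ ∙ x) ⁻¹     ≡⟨ ⁻¹-anti-homo-∙ (g ⁻¹ ∙ x) g ⟨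
    (g ⁻¹ ∙ x ∙ g) ⁻¹        ∎

  conj-ε : ∀ g → conj g ε ≡ ε
  conj-ε g = trans (cong (_∙ g) (identityʳ (g ⁻¹))) (inverseˡ g)

  conj-by-ε : ∀ z → conj ε z ≡ z
  conj-by-ε z = trans (identityʳ (ε ⁻¹ ∙ z)) (trans (cong (_∙ z) ε⁻¹≈ε) (identityˡ z))

  conj-by-∙ : ∀ a b z → conj (a ∙ b) z ≡ conj b (conj a z)
  conj-by-∙ a b z = begin
    (a ∙ b) ⁻¹ ∙ z ∙ (a ∙ b)   ≡⟨ cong (λ t → t ∙ z ∙ (a ∙ b)) (⁻¹-anti-homo-∙ a b) ⟩
    b ⁻¹ ∙ a ⁻¹ ∙ z ∙ (a ∙ b)  ≡⟨ assoc _ a b ⟨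
    b ⁻¹ ∙ a ⁻¹ ∙ z ∙ a ∙ b    ≡⟨ cong (λ t → t ∙ a ∙ b) (assoc (b ⁻¹) (a ⁻¹) z) ⟩
    b ⁻¹ ∙ (a ⁻¹ ∙ z) ∙ a ∙ b  ≡⟨ cong (_∙ b) (assoc (b ⁻¹) (a ⁻¹ ∙ z) a) ⟩
    b ⁻¹ ∙ (a ⁻¹ ∙ z ∙ a) ∙ b  ∎

  \\-cancelˡ : ∀ p q r → (p \\ q) \\ (p \\ r) ≡ q \\ r
  \\-cancelˡ p q r = begin
    (p ⁻¹ ∙ q) ⁻¹ ∙ (p ⁻¹ ∙ r)     ≡⟨ cong (_∙ (p ⁻¹ ∙ r)) (⁻¹-anti-homo-∙ (p ⁻¹) q) ⟩
    q ⁻¹ ∙ p ⁻¹ ⁻¹ ∙ (p ⁻¹ ∙ r)    ≡⟨ assoc (q ⁻¹) _ _ ⟩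
    q ⁻¹ ∙ (p ⁻¹ ⁻¹ ∙ (p ⁻¹ ∙ r))  ≡⟨ cong (q ⁻¹ ∙_) (\\-leftDividesʳ (p ⁻¹) r) ⟩
    q ⁻¹ ∙ r                       ∎

  ∙ʳ-\\ : ∀ x y c → (y ∙ c) \\ (x ∙ c) ≡ conj c (y \\ x)
  ∙ʳ-\\ x y c = begin
    (y ∙ c) ⁻¹ ∙ (x ∙ c)     ≡⟨ cong (_∙ (x ∙ c)) (⁻¹-anti-homo-∙ y c) ⟩
    c ⁻¹ ∙ y ⁻¹ ∙ (x ∙ c)    ≡⟨ assoc (c ⁻¹) (y ⁻¹) _ ⟩
    c ⁻¹ ∙ (y ⁻¹ ∙ (x ∙ c))  ≡⟨ cong (c ⁻¹ ∙_) (assoc (y ⁻¹) x c) ⟨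
    c ⁻¹ ∙ (y ⁻¹ ∙ x ∙ c)    ≡⟨ assoc (c ⁻¹) _ c ⟨
    c ⁻¹ ∙ (y ⁻¹ ∙ x) ∙ c    ∎

  ∙ʳ-// : ∀ g h c → (h ∙ c) // (g ∙ c) ≡ h // g
  ∙ʳ-// g h c = begin
    h ∙ c ∙ (g ∙ c) ⁻¹     ≡⟨ cong (h ∙ c ∙_) (⁻¹-anti-homo-∙ g c) ⟩
    h ∙ c ∙ (c ⁻¹ ∙ g ⁻¹)  ≡⟨ assoc (h ∙ c) (c ⁻¹) (g ⁻¹) ⟨
    h ∙ c ∙ c ⁻¹ ∙ g ⁻¹    ≡⟨ cong (_∙ g ⁻¹) (//-rightDividesʳ c h) ⟩
    h ∙ g ⁻¹               ∎

  \\≡ε⇒≡ : ∀ {x y} → x \\ y ≡ ε → x ≡ y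
  \\≡ε⇒≡ {x} {y} x\\y≡ε = begin
    x             ≡⟨ identityʳ x ⟨
    x ∙ ε         ≡⟨ cong (x ∙_) x\\y≡ε ⟨
    x ∙ (x \\ y)  ≡⟨ \\-leftDividesˡ x y ⟩
    y             ∎

  record IsSubgroup (N : Carrier → Set) : Set where
    field
      ε-closed  : N ε
      ∙-closed  : ∀ {x y} → N x → N y → N (x ∙ y)
      ⁻¹-closed : ∀ {x} → N x → N (x ⁻¹)

    conj-closed : ∀ {g z} → N g → N z → N (conj g z)
    conj-closed ng nz = ∙-closed (∙-closed (⁻¹-closed ng) nz) ng

    \\-closed : ∀ {p q r} → N (p \\ q) → N (p \\ r) → N (q \\ r)
    \\-closed {p} {q} {r} npq npr = subst N (\\-cancelˡ p q r) (∙-closed (⁻¹-closed npq) npr)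

  NormalCore : (Carrier → Set) → Carrier → Set
  NormalCore N z = ∀ g → N (conj g z)

  module _ {N : Carrier → Set} (N-sub : IsSubgroup N) where
    open IsSubgroup N-sub

    normalCore-isNormal : IsNormalSubgroup Γ (NormalCore N)
    normalCore-isNormal = record
      { has-ε       = λ g → subst N (sym (conj-ε g)) ε-closed
      ; ∙-closed    = λ {x} {y} cx cy g → subst N (sym (conj-∙ g x y)) (∙-closed (cx g) (cy g))
      ; ⁻¹-closed   = λ {x} cx g → subst N (sym (conj-⁻¹ g x)) (⁻¹-closed (cx g))
      ; conj-closed = λ {x} h cx g → subst N (conj-by-h⁻¹∙g h g x) (cx (h ⁻¹ ∙ g))
      }
      where
        conj-by-h⁻¹∙g : ∀ h g x → conj (h ⁻¹ ∙ g) x ≡ conj g (h ∙ x ∙ h ⁻¹)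
        conj-by-h⁻¹∙g h g x = trans (conj-by-∙ (h ⁻¹) g x)
                                    (cong (λ t → conj g (t ∙ x ∙ h ⁻¹)) (⁻¹-involutive h))

    normalCore⊆ : ∀ {z} → NormalCore N z → N z
    normalCore⊆ {z} core = subst N (conj-by-ε z) (core ε)

  CosetRepresentatives : (Carrier → Set) → List Carrier → Set
  CosetRepresentatives N reps = ∀ v → Σ Carrier λ r → r ∈ reps × N (r \\ v)

  HasFiniteIndex : (Carrier → Set) → Set
  HasFiniteIndex N = Σ (List Carrier) (CosetRepresentatives N)

  module CosetAction {N : Carrier → Set} (N-sub : IsSubgroup N)
                     {reps : List Carrier} (cover : CosetRepresentatives N reps) where
    open IsSubgroup N-sub

    rep : Fin (length reps) → Carrier
    rep = lookup reps

    cosetOf : Carrier → Fin (length reps)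
    cosetOf v = index (proj₁ (proj₂ (cover v)))

    ∈-rep-cosetOf : ∀ v → N (rep (cosetOf v) \\ v)
    ∈-rep-cosetOf v with cover v
    ... | r , r∈reps , nv = subst (λ r′ → N (r′ \\ v)) (lookup-index r∈reps) nv

    act : Carrier → Fin (length reps) → Fin (length reps)
    act x i = cosetOf (x ∙ rep i)

    sameAction⇒normalCore : ∀ {x y} → (∀ i → act x i ≡ act y i) → NormalCore N (y \\ x)
    sameAction⇒normalCore {x} {y} same g =
      subst N conj-by-g (conj-closed (∈-rep-cosetOf g) (subst N (∙ʳ-\\ x y r) xr∼yr))
      where
        r : Carrier
        r = rep (cosetOf g)
        yr∈xr-coset : N (rep (act x (cosetOf g)) \\ (y ∙ r))
        yr∈xr-coset = subst (λ j → N (rep j \\ (y ∙ r))) (sym (same (cosetOf g)))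
                            (∈-rep-cosetOf (y ∙ r))
        xr∼yr : N ((y ∙ r) \\ (x ∙ r))
        xr∼yr = \\-closed yr∈xr-coset (∈-rep-cosetOf (x ∙ r))
        conj-by-g : conj (r \\ g) (conj r (y \\ x)) ≡ conj g (y \\ x)
        conj-by-g = trans (sym (conj-by-∙ r (r \\ g) (y \\ x)))
                          (cong (λ t → conj t (y \\ x)) (\\-leftDividesˡ r g))

  IsFinite : Set
  IsFinite = Σ (List Carrier) λ xs → (x : Carrier) → x ∈ xs

  module Balls (S : List Carrier) where
    S± : List Carrier
    S± = S ++ map _⁻¹ S

    neighbours : List Carrier → List Carrier
    neighbours ws = cartesianProductWith _∙_ ws S±

    ball : ℕ → List Carrier
    ball zero    = [ ε ]
    ball (suc n) = ball n ++ neighbours (ball n)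

    ε∈ball : ∀ n → ε ∈ ball n
    ε∈ball zero    = here refl
    ε∈ball (suc n) = ∈-++⁺ˡ (ε∈ball n)

    ball-mono : ∀ {m n x} → m ≤′ n → x ∈ ball m → x ∈ ball n
    ball-mono ≤′-refl        x∈ball = x∈ball
    ball-mono (≤′-step m≤′n) x∈ball = ∈-++⁺ˡ (ball-mono m≤′n x∈ball)

    ∙s∈neighbours : ∀ {w ws s} → w ∈ ws → s ∈ S → w ∙ s ∈ neighbours ws
    ∙s∈neighbours w∈ws s∈S = ∈-cartesianProductWith⁺ _∙_ w∈ws (∈-++⁺ˡ s∈S)

    ∙s⁻¹∈neighbours : ∀ {w ws s} → w ∈ ws → s ∈ S → w ∙ s ⁻¹ ∈ neighbours ws
    ∙s⁻¹∈neighbours w∈ws s∈S = ∈-cartesianProductWith⁺ _∙_ w∈ws (∈-++⁺ʳ S (∈-map⁺ _⁻¹ s∈S))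

    Closed : List Carrier → Set
    Closed ws = All (_∈ ws) (neighbours ws)

    closed⇒generated⊆ : ∀ {ws x} → ε ∈ ws → Closed ws → Generated Γ S x → x ∈ ws
    closed⇒generated⊆ ε∈ws closed gen-ε             = ε∈ws
    closed⇒generated⊆ ε∈ws closed (gen-s   gx s∈S) =
      All.lookup closed (∙s∈neighbours (closed⇒generated⊆ ε∈ws closed gx) s∈S)
    closed⇒generated⊆ ε∈ws closed (gen-s⁻¹ gx s∈S) =
      All.lookup closed (∙s⁻¹∈neighbours (closed⇒generated⊆ ε∈ws closed gx) s∈S)

  -- Constructively, an injection into Fin M does not by itself enumerate Γ. The balls
  -- around ε are grown instead: while a ball is not closed under neighbours the next one
  -- gains a new element, and by pigeonhole on σ this cannot happen M + 1 times in a row.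
  module _ (S : List Carrier) (gens : Generates Γ S)
           {M : ℕ} (σ : Carrier → Fin M) (σ-injective : Injective _≡_ _≡_ σ) where
    open Balls S

    _≟_ : DecidableEquality Carrier
    x ≟ y = map′ σ-injective (cong σ) (σ x ≟ᶠ σ y)

    open import Data.List.Membership.DecPropositional _≟_ using (_∈?_)

    closed? : ∀ ws → Dec (Closed ws)
    closed? ws = All.all? (_∈? ws) (neighbours ws)

    escapee : ∀ n → ¬ Closed (ball n) → Σ Carrier λ y → y ∈ ball (suc n) × y ∉ ball n
    escapee n open-ball with find (¬All⇒Any¬ (_∈? ball n) _ open-ball)
    ... | y , y∈nbrs , y∉ball = y , ∈-++⁺ʳ (ball n) y∈nbrs , y∉ball

    someBallClosed : Σ ℕ λ n → Closed (ball n)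
    someBallClosed with any? (λ (i : Fin (suc M)) → closed? (ball (toℕ i)))
    ... | yes (i , closed) = toℕ i , closed
    ... | no noneClosed    = ⊥-elim (distinct (pigeonhole (n<1+n M) (σ ∘ new)))
      where
        escape : ∀ i → Σ Carrier λ y → y ∈ ball (suc (toℕ i)) × y ∉ ball (toℕ i)
        escape i = escapee (toℕ i) (λ closed → noneClosed (i , closed))
        new : Fin (suc M) → Carrier
        new i = proj₁ (escape i)
        new∈later-ball : ∀ {i j} → i Fin.< j → new i ∈ ball (toℕ j)
        new∈later-ball {i} i<j = ball-mono (≤⇒≤′ i<j) (proj₁ (proj₂ (escape i)))
        distinct : ¬ Σ (Fin (suc M)) λ i → Σ (Fin (suc M)) λ j → i Fin.< j × σ (new i) ≡ σ (new j)
        distinct (i , j , i<j , same) =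
          proj₂ (proj₂ (escape j)) (subst (_∈ ball (toℕ j)) (σ-injective same) (new∈later-ball i<j))

    injective-into-Fin⇒finite : IsFinite
    injective-into-Fin⇒finite with someBallClosed
    ... | n , closed = ball n , λ x → closed⇒generated⊆ (ε∈ball n) closed (gens x)

  finiteIndex⇒whole : (S : List Carrier) → Generates Γ S → IsInfinite Γ → IsSimple Γ →
                      ∀ {N} → IsSubgroup N → HasFiniteIndex N → ∀ x → N x
  finiteIndex⇒whole S gens infinite simple {N} N-sub (reps , cover)
    with simple (NormalCore N) (normalCore-isNormal N-sub)
  ... | inj₂ core-whole   = λ x → normalCore⊆ N-sub (core-whole x)
  ... | inj₁ core-trivial =
    ⊥-elim (infinite (injective-into-Fin⇒finite S gens encode encode-injective))
    where
      open CosetAction N-sub cover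

      encode : Carrier → Fin (length reps ^ length reps)
      encode = funToFin ∘ act

      encode-injective : Injective _≡_ _≡_ encode
      encode-injective {x} {y} same-code =
        sym (\\≡ε⇒≡ (core-trivial (y \\ x) (sameAction⇒normalCore same-action)))
        where
          same-action : ∀ i → act x i ≡ act y i
          same-action i = begin
            act x i                ≡⟨ finToFun-funToFin (act x) i ⟨
            finToFun (encode x) i  ≡⟨ cong (λ e → finToFun e i) same-code ⟩
            finToFun (encode y) i  ≡⟨ finToFun-funToFin (act y) i ⟩
            act y i                ∎

  RightInvariant : {C : Set} → (Carrier → C) → Carrier → Set
  RightInvariant c γ = ∀ g → c (g ∙ γ) ≡ c g

  rightInvariant-isSubgroup : ∀ {C} (c : Carrier → C) → IsSubgroup (RightInvariant c)
  rightInvariant-isSubgroup c = record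
    { ε-closed  = λ g → cong c (identityʳ g)
    ; ∙-closed  = λ {x} {y} cx cy g →
        trans (cong c (sym (assoc g x y))) (trans (cy (g ∙ x)) (cx g))
    ; ⁻¹-closed = λ {x} cx g → trans (sym (cx (g ∙ x ⁻¹))) (cong c (//-rightDividesˡ x g))
    }

  rightInvariant⇒constant : ∀ {C} (c : Carrier → C) →
                            (∀ γ → RightInvariant c γ) → ∀ g h → c g ≡ c h
  rightInvariant⇒constant c invariant g h =
    trans (sym (invariant (g \\ h) g)) (cong c (\\-leftDividesˡ g h))

  RightInvariant₂ : (Carrier → Carrier → Set) → Carrier → Set
  RightInvariant₂ O γ = ∀ g h → O g h → O (g ∙ γ) (h ∙ γ)

  module _ (S : List Carrier) where

    IsRightMultiplication : Aut Γ S → Carrier → Set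
    IsRightMultiplication φ γ = ∀ g → to φ g ≡ g ∙ γ

    grr∧periodic⇒finiteIndex : IsGRR Γ S → ∀ {H N} → FinitelyManyOrbits Γ S H →
                               (∀ φ γ → H φ → IsRightMultiplication φ γ → N γ) → HasFiniteIndex N
    grr∧periodic⇒finiteIndex grr {H} {N} (reps , orbit) H⇒N = reps , coset
      where
        coset : CosetRepresentatives N reps
        coset v with orbit v
        ... | r , r∈reps , φ , Hφ , φr≡v with grr φ
        ... | γ , φ≡∙γ = r , r∈reps , subst N γ≡r\\v (H⇒N φ γ Hφ φ≡∙γ)
          where
            γ≡r\\v : γ ≡ r \\ v
            γ≡r\\v = begin
              γ             ≡⟨ \\-leftDividesʳ r γ ⟨
              r \\ (r ∙ γ)  ≡⟨ cong (r \\_) (trans (sym (φ≡∙γ r)) φr≡v) ⟩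
              r \\ v        ∎

    colorPreserving⇒rightInvariant : ∀ {C} {c : Carrier → C} φ γ → ColorPreserving Γ S c φ →
                                     IsRightMultiplication φ γ → RightInvariant c γ
    colorPreserving⇒rightInvariant {c = c} φ γ preserves φ≡∙γ g =
      trans (cong c (sym (φ≡∙γ g))) (preserves g)

    orientationPreserving⇒rightInvariant₂ : ∀ {O} φ γ → OrientationPreserving Γ S O φ →
                                            IsRightMultiplication φ γ → RightInvariant₂ O γ
    orientationPreserving⇒rightInvariant₂ {O} φ γ preserves φ≡∙γ g h o =
      subst₂ O (φ≡∙γ g) (φ≡∙γ h) (preserves g h o)

    adj-∙ʳ : ∀ γ {g h} → Adj Γ S g h → Adj Γ S (g ∙ γ) (h ∙ γ)
    adj-∙ʳ γ {g} {h} = subst (λ t → t ∈ S ⊎ t ⁻¹ ∈ S) (sym (∙ʳ-// g h γ))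

    adj-ε : ∀ {s} → s ∈ S → Adj Γ S ε s
    adj-ε {s} s∈S = inj₁ (subst (_∈ S) (sym (trans (cong (s ∙_) ε⁻¹≈ε) (identityʳ s))) s∈S)

    module _ {O : Carrier → Carrier → Set} (O-orientation : IsOrientation Γ S O) where
      open IsOrientation O-orientation

      rightInvariant₂-isSubgroup : IsSubgroup (RightInvariant₂ O)
      rightInvariant₂-isSubgroup = record
        { ε-closed  = λ g h o → subst₂ O (sym (identityʳ g)) (sym (identityʳ h)) o
        ; ∙-closed  = λ {x} {y} ox oy g h o →
            subst₂ O (assoc g x y) (assoc h x y) (oy _ _ (ox g h o))
        ; ⁻¹-closed = ⁻¹-closed
        }
        where
          ⁻¹-closed : ∀ {x} → RightInvariant₂ O x → RightInvariant₂ O (x ⁻¹)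
          ⁻¹-closed {x} ox g h o
            with total (g ∙ x ⁻¹) (h ∙ x ⁻¹) (adj-∙ʳ (x ⁻¹) (only-edges g h o))
          ... | inj₁ o′ = o′
          ... | inj₂ o′ =
            ⊥-elim (antisym g h o (subst₂ O (//-rightDividesˡ x h) (//-rightDividesˡ x g) (ox _ _ o′)))

      involution⇒¬rightInvariant₂ : ∀ {s} → s ∈ S → s ∙ s ≡ ε → ¬ RightInvariant₂ O s
      involution⇒¬rightInvariant₂ {s} s∈S ss≡ε invariant with total ε s (adj-ε s∈S)
      ... | inj₁ o = antisym ε s o (subst₂ O (identityˡ s) ss≡ε (invariant ε s o))
      ... | inj₂ o = antisym ε s (subst₂ O ss≡ε (identityˡ s) (invariant s ε o)) o

lemma3p2 : (Γ : Grp) → (S : List (Grp.Carrier Γ)) →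
    IsInfinite Γ → IsSimple Γ → Generates Γ S → ¬ (Grp.ε Γ ∈ S) → IsGRR Γ S →
    ((C : Set) → (c : Grp.Carrier Γ → C) → PeriodicColoring Γ S c → TrivialColoring Γ S c)
    × ((Σ (Grp.Carrier Γ) λ s → s ∈ S × ¬ (s ≡ Grp.ε Γ) × Grp._∙_ Γ s s ≡ Grp.ε Γ) →
       ¬ HasPeriodicOrientation Γ S)
-- Colourings come out constant.
lemma3p2 Γ S infinite simple gens _ grr = periodic⇒trivial , involution⇒¬periodic
  where
    open Grp Γ using (Carrier; ε; _∙_)

    whole : ∀ {N} → IsSubgroup Γ N → HasFiniteIndex Γ N → ∀ x → N x
    whole = finiteIndex⇒whole Γ S gens infinite simple

    periodic⇒trivial : (C : Set) (c : Carrier → C) →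
                       PeriodicColoring Γ S c → TrivialColoring Γ S c
    periodic⇒trivial C c periodic g h _ = rightInvariant⇒constant Γ c invariant g h
      where
        invariant : ∀ γ → RightInvariant Γ c γ
        invariant = whole (rightInvariant-isSubgroup Γ c)
          (grr∧periodic⇒finiteIndex Γ S grr periodic (colorPreserving⇒rightInvariant Γ S))

    involution⇒¬periodic : (Σ Carrier λ s → s ∈ S × ¬ (s ≡ ε) × s ∙ s ≡ ε) →
                           ¬ HasPeriodicOrientation Γ S
    involution⇒¬periodic (s , s∈S , _ , ss≡ε) (O , O-orientation , periodic) =
      involution⇒¬rightInvariant₂ Γ S O-orientation s∈S ss≡ε (invariant s)
      where
        invariant : ∀ γ → RightInvariant₂ Γ O γ
        invariant = whole (rightInvariant₂-isSubgroup Γ S O-orientation)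
          (grr∧periodic⇒finiteIndex Γ S grr periodic (orientationPreserving⇒rightInvariant₂ Γ S))
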